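{- Let $M$ be a matroid on $E$, $\mathcal{C}$ a circuit signature and $\mathcal{C}^*$ a cocircuit signature of $M$. Suppose (1) the pair $\mathcal{C},\mathcal{C}^*$ has the 4-painting property (4P), and (2) for every partition $E=B\,\dot\cup\,W\,\dot\cup\,G\,\dot\cup\,R$ and every $e\in B\cup W$: if some $C\in\mathcal{C}$ satisfies $e\in\underline{C}\subseteq B\cup W\cup G$, $\underline{C}\cap B\subseteq C^+$, $\underline{C}\cap W\subseteq C^-$, then among all such $C$ there is one for which $\underline{C|_{B\cup W}}$ is a circuit of $M/G\setminus R$; and if some $U\in\mathcal{C}^*$ satisfies $e\in\underline{U}\subseteq B\cup W\cup R$, $\underline{U}\cap B\subseteq U^+$, $\underline{U}\cap W\subseteq U^-$, then among all such $U$ there is one for which $\underline{U|_{B\cup W}}$ is a cocircuit of $M/G\setminus R$. Then $(M,\mathcal{C},\mathcal{C}^*)$ is a Farkas property oriented matroid on $E$.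
   Context: Matroids are in the sense of Bruhn, Diestel, Kriesell, Pendavingh and Wollan (possibly infinite ground set); cocircuits are circuits of the dual. A signed subset $X$ of $E$ is a support $\underline{X}\subseteq E$ with a partition $(X^+,X^-)$; $-X$ swaps the parts; $X|_A$ has parts $X^\pm\cap A$; $X$ is positive if $\underline{X}=X^+\neq\emptyset$. The reorientation ${}_{ -A}X$ has ${}_{ -A}X^+=(X^+\setminus A)\cup(X^-\cap A)$, ${}_{ -A}X^-=(X^-\setminus A)\cup(X^+\cap A)$, and ${}_{ -A}\mathcal{S}=\{{}_{ -A}X:X\in\mathcal{S}\}$. A circuit signature of $M$ is a set of signed subsets consisting of exactly two opposite signed subsets supported by each circuit; a cocircuit signature is a circuit signature of $M^*$. A pair $\mathcal{S},\mathcal{T}$ of sets of signed subsets of $E'$ has the Farkas property if for every $e\in E'$ exactly one holds: some positive $X\in\mathcal{S}$ has $e\in\underline{X}$, or some positive $Y\in\mathcal{T}$ has $e\in\underline{Y}$. For a minor $N=M/F\setminus G$ with ground set $E(N)$: $\mathcal{S}^{\mathcal{C}}(N)=\{C|_{E(N)}: C\in\mathcal{C},\ \underline{C|_{E(N)}}\text{ a circuit of }N,\ \underline{C}\subseteq E(N)\cup F\}$, $\mathcal{S}^{\mathcal{C}^*}(N)=\{U|_{E(N)}:U\in\mathcal{C}^*,\ \underline{U|_{E(N)}}\text{ a cocircuit of }N,\ \underline{U}\subseteq E(N)\cup G\}$. $(M,\mathcal{C},\mathcal{C}^*)$ is Farkas property oriented if for every minor $N$ and every $A\subseteq E(N)$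 the pair ${}_{ -A}\mathcal{S}^{\mathcal{C}}(N),{}_{ -A}\mathcal{S}^{\mathcal{C}^*}(N)$ has the Farkas property. A pair $\mathcal{S},\mathcal{T}$ has the 4-painting property (4P) if for every partition $E=B\,\dot\cup\,W\,\dot\cup\,G\,\dot\cup\,R$ and every $e\in B\cup W$ exactly one holds: there is $X\in\mathcal{S}$ with $e\in\underline{X}\subseteq B\cup W\cup G$, $\underline{X}\cap B\subseteq X^+$, $\underline{X}\cap W\subseteq X^-$; or there is $Y\in\mathcal{T}$ with $e\in\underline{Y}\subseteq B\cup W\cup R$, $\underline{Y}\cap B\subseteq Y^+$, $\underline{Y}\cap W\subseteq Y^-$. -}

module Defs where

open import Data.Bool using (Bool; true; false; not; _∧_; _∨_)
open import Data.Product using (Σ; ∃; _×_; _,_)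
open import Data.Sum using (_⊎_)
open import Data.Empty using (⊥)
open import Relation.Nullary using (¬_)
open import Relation.Binary.PropositionalEquality using (_≡_)

Subset : Set → Set
Subset E = E → Bool

module _ {E : Set} where

  _∈_ : E → Subset E → Set
  x ∈ S = S x ≡ true

  _⊆_ : Subset E → Subset E → Set
  A ⊆ B = ∀ x → x ∈ A → x ∈ B

  _≐_ : Subset E → Subset E → Set
  A ≐ B = ∀ x → A x ≡ B x

  ∅ : Subset E
  ∅ _ = false

  full : Subset E
  full _ = true

  _∪_ : Subset E → Subset E → Subset E
  (A ∪ B) x = A x ∨ B x

  _∖_ : Subset E → Subset E → Subset E
  (A ∖ B) x = A x ∧ not (B x)

  Disjoint : Subset E → Subset E → Set
  Disjoint A B = ∀ x → x ∈ A → x ∈ B → ⊥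

record PreMatroid (E : Set) : Set₁ where
  field
    ground : Subset E
    indep  : Subset E → Set
open PreMatroid public

module _ {E : Set} where

  Base : PreMatroid E → Subset E → Set
  Base M B = indep M B × (∀ J → indep M J → B ⊆ J → J ⊆ B)

  -- independence axioms of Bruhn–Diestel–Kriesell–Pendavingh–Wollan
  record IsMatroid (M : PreMatroid E) : Set where
    field
      I0 : ∀ I → indep M I → I ⊆ ground M
      I1 : indep M ∅
      I2 : ∀ I J → indep M I → J ⊆ I → indep M J
      I3 : ∀ I I' → indep M I → ¬ Base M I → Base M I' →
           Σ E λ x → x ∈ I' × ¬ (x ∈ I) ×
             Σ (Subset E) λ J → indep M J × I ⊆ J × x ∈ J ×
               (∀ y → y ∈ J → y ∈ I ⊎ y ≡ x)
      IM : ∀ I X → indep M I → I ⊆ X → X ⊆ ground M →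
           Σ (Subset E) λ J → indep M J × I ⊆ J × J ⊆ X ×
             (∀ J' → indep M J' → J ⊆ J' → J' ⊆ X → J' ⊆ J)

  Circuit : PreMatroid E → Subset E → Set
  Circuit M C = C ⊆ ground M × ¬ indep M C ×
                (∀ D → D ⊆ C → ¬ (C ⊆ D) → indep M D)

  -- dual: bases are the complements (in the ground set) of bases
  dual : PreMatroid E → PreMatroid E
  dual M = record
    { ground = ground M
    ; indep  = λ J → J ⊆ ground M × Σ (Subset E) λ B → Base M B × Disjoint J B }

  Cocircuit : PreMatroid E → Subset E → Set
  Cocircuit M C = Circuit (dual M) C

  delete : PreMatroid E → Subset E → PreMatroid E
  delete M X = record
    { ground = ground M ∖ X
    ; indep  = λ I → indep M I × I ⊆ (ground M ∖ X) }

  contract : PreMatroid E → Subset E → PreMatroid E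
  contract M X = dual (delete (dual M) X)

  minor : PreMatroid E → Subset E → Subset E → PreMatroid E
  minor M F G = delete (contract M F) G

-- Signed subsets: X x = ⊕ (x ∈ X⁺), ⊖ (x ∈ X⁻), ○ (x ∉ support)

data Sign : Set where
  ⊕ ⊖ ○ : Sign

flipS : Sign → Sign
flipS ⊕ = ⊖
flipS ⊖ = ⊕
flipS ○ = ○

isNonzero : Sign → Bool
isNonzero ○ = false
isNonzero _ = true

isPlus : Sign → Bool
isPlus ⊕ = true
isPlus _ = false

Signed : Set → Set
Signed E = E → Sign

Exactly : Set → Set → Set
Exactly P Q = (P ⊎ Q) × ¬ (P × Q)

SignedSet : Set → Set₁
SignedSet E = Signed E → Set

module _ {E : Set} where

  _≗ˢ_ : Signed E → Signed E → Set
  X ≗ˢ Y = ∀ x → X x ≡ Y x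

  support : Signed E → Subset E
  support X x = isNonzero (X x)

  plusPart : Signed E → Subset E
  plusPart X x = isPlus (X x)

  negS : Signed E → Signed E
  negS X x = flipS (X x)

  restrict : Signed E → Subset E → Signed E
  restrict X A x with A x
  ... | true  = X x
  ... | false = ○

  reorient : Subset E → Signed E → Signed E
  reorient A X x with A x
  ... | true  = flipS (X x)
  ... | false = X x

  reorientSet : Subset E → SignedSet E → SignedSet E
  reorientSet A 𝒮 Z = Σ (Signed E) λ X → 𝒮 X × Z ≗ˢ reorient A X

  Positive : Signed E → Set
  Positive X = support X ≐ plusPart X × Σ E λ x → x ∈ support X

  IsCircuitSignature : PreMatroid E → SignedSet E → Set
  IsCircuitSignature M 𝒞 =
    (∀ X → 𝒞 X → Circuit M (support X)) ×
    (∀ C → Circuit M C → Σ (Signed E) λ X → support X ≐ C ×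
       (∀ Y → (𝒞 Y × support Y ≐ C → Y ≗ˢ X ⊎ Y ≗ˢ negS X) ×
              (Y ≗ˢ X ⊎ Y ≗ˢ negS X → 𝒞 Y)))

  IsCocircuitSignature : PreMatroid E → SignedSet E → Set
  IsCocircuitSignature M 𝒞 = IsCircuitSignature (dual M) 𝒞

  FarkasProperty : Subset E → SignedSet E → SignedSet E → Set
  FarkasProperty E' 𝒮 𝒯 = ∀ e → e ∈ E' →
    Exactly (Σ (Signed E) λ X → 𝒮 X × Positive X × e ∈ support X)
            (Σ (Signed E) λ Y → 𝒯 Y × Positive Y × e ∈ support Y)

  SC : PreMatroid E → SignedSet E → Subset E → Subset E → SignedSet E
  SC M 𝒞 F G Z = Σ (Signed E) λ C → 𝒞 C ×
    Z ≗ˢ restrict C (ground (minor M F G)) ×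
    Circuit (minor M F G) (support Z) ×
    support C ⊆ (ground (minor M F G) ∪ F)

  SC* : PreMatroid E → SignedSet E → Subset E → Subset E → SignedSet E
  SC* M 𝒞* F G Z = Σ (Signed E) λ U → 𝒞* U ×
    Z ≗ˢ restrict U (ground (minor M F G)) ×
    Cocircuit (minor M F G) (support Z) ×
    support U ⊆ (ground (minor M F G) ∪ G)

  FarkasPropertyOriented : PreMatroid E → SignedSet E → SignedSet E → Set
  FarkasPropertyOriented M 𝒞 𝒞* =
    ∀ (F G : Subset E) → Disjoint F G → ∀ (A : Subset E) →
      A ⊆ ground (minor M F G) →
      FarkasProperty (ground (minor M F G))
        (reorientSet A (SC M 𝒞 F G)) (reorientSet A (SC* M 𝒞* F G))

-- Partitions E = B ⊍ W ⊍ G ⊍ R, given as colourings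

data Colour : Set where
  cB cW cG cR : Colour

_==ᶜ_ : Colour → Colour → Bool
cB ==ᶜ cB = true
cW ==ᶜ cW = true
cG ==ᶜ cG = true
cR ==ᶜ cR = true
_  ==ᶜ _  = false

module _ {E : Set} where

  colSet : (E → Colour) → Colour → Subset E
  colSet p c x = p x ==ᶜ c

  Painted : (E → Colour) → Colour → Signed E → E → Set
  Painted p K X e = e ∈ support X ×
    (∀ x → x ∈ support X → p x ≡ cB ⊎ p x ≡ cW ⊎ p x ≡ K) ×
    (∀ x → x ∈ support X → p x ≡ cB → X x ≡ ⊕) ×
    (∀ x → x ∈ support X → p x ≡ cW → X x ≡ ⊖)

  FourPainting : SignedSet E → SignedSet E → Set
  FourPainting 𝒮 𝒯 = ∀ (p : E → Colour) (e : E) → (p e ≡ cB ⊎ p e ≡ cW) →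
    Exactly (Σ (Signed E) λ X → 𝒮 X × Painted p cG X e)
            (Σ (Signed E) λ Y → 𝒯 Y × Painted p cR Y e)

  MinimalChoice : PreMatroid E → SignedSet E → SignedSet E → Set
  MinimalChoice M 𝒞 𝒞* = ∀ (p : E → Colour) (e : E) → (p e ≡ cB ⊎ p e ≡ cW) →
    ((Σ (Signed E) λ C → 𝒞 C × Painted p cG C e) →
       Σ (Signed E) λ C → 𝒞 C × Painted p cG C e ×
         Circuit (minor M (colSet p cG) (colSet p cR))
                 (support (restrict C (colSet p cB ∪ colSet p cW)))) ×
    ((Σ (Signed E) λ U → 𝒞* U × Painted p cR U e) →
       Σ (Signed E) λ U → 𝒞* U × Painted p cR U e ×
         Cocircuit (minor M (colSet p cG) (colSet p cR))
                   (support (restrict U (colSet p cB ∪ colSet p cW))))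

-- Given a minor M/F\G with ground set N and a reorientation A ⊆ N, paint F green, G red,
-- N ∩ A white and N ∖ A black. A signed circuit C with C̲ ⊆ N ∪ F restricts and reorients
-- to a positive signed set containing e exactly when C is painted as in (4P) with e ∈ C̲;
-- dually for cocircuits with G in place of F. So (4P) turns into the Farkas property of the
-- minor, with hypothesis (2) supplying a C whose restriction really is a circuit of the
-- minor.
module Submission where

open import Defs
open import Data.Bool using (true; false; not; _∧_; _∨_; if_then_else_)
open import Data.Bool.Properties using (∨-zeroʳ)
open import Data.Product using (Σ; _×_; _,_; proj₁; proj₂)
open import Data.Sum using (_⊎_; inj₁; inj₂)
import Data.Sum as Sum
open import Data.Empty using (⊥-elim)
open import Function using (case_of_)
open import Function.Bundles using (_⇔_; mk⇔; Equivalence)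
open import Relation.Nullary using (¬_)
open import Relation.Binary.PropositionalEquality using (_≡_; refl; sym; trans; cong; cong₂)

open Equivalence using (to; from)

module _ {E : Set} where

  ≐-refl : {S : Subset E} → S ≐ S
  ≐-refl _ = refl

  ≐-sym : {S T : Subset E} → S ≐ T → T ≐ S
  ≐-sym S≐T x = sym (S≐T x)

  ⊆-resp-≐ : {S S' T T' : Subset E} → S ≐ S' → T ≐ T' → S ⊆ T → S' ⊆ T'
  ⊆-resp-≐ S≐S' T≐T' S⊆T x x∈S' = trans (sym (T≐T' x)) (S⊆T x (trans (S≐S' x) x∈S'))

  ∈-∪ˡ : {S T : Subset E} {x : E} → x ∈ S → x ∈ (S ∪ T)
  ∈-∪ˡ x∈S = cong (_∨ _) x∈S

  ∈-∪ʳ : {S T : Subset E} {x : E} → x ∈ T → x ∈ (S ∪ T)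
  ∈-∪ʳ {S} {x = x} x∈T = trans (cong (S x ∨_) x∈T) (∨-zeroʳ (S x))

  ∉-∪ : {S T : Subset E} {x : E} → S x ≡ false → T x ≡ false → ¬ x ∈ (S ∪ T)
  ∉-∪ x∉S x∉T x∈S∪T = case trans (sym (cong₂ _∨_ x∉S x∉T)) x∈S∪T of λ ()

module _ {E : Set} where

  IndepTransfer : PreMatroid E → PreMatroid E → Set
  IndepTransfer M M' = ∀ {I I'} → I ≐ I' → indep M I → indep M' I'

  _≈ᴹ_ : PreMatroid E → PreMatroid E → Set
  M ≈ᴹ M' = (ground M ≐ ground M') × IndepTransfer M M' × IndepTransfer M' M

  ≈ᴹ-sym : {M M' : PreMatroid E} → M ≈ᴹ M' → M' ≈ᴹ M
  ≈ᴹ-sym (ground≐ , there , back) = ≐-sym ground≐ , back , there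

  Base-resp : {M M' : PreMatroid E} → M ≈ᴹ M' → {B B' : Subset E} → B ≐ B' →
              Base M B → Base M' B'
  Base-resp (_ , there , back) B≐B' (B-indep , B-maximal) =
    there B≐B' B-indep ,
    λ J J-indep B'⊆J → ⊆-resp-≐ ≐-refl B≐B'
      (B-maximal J (back ≐-refl J-indep) (⊆-resp-≐ (≐-sym B≐B') ≐-refl B'⊆J))

  dual-indepTransfer : {M M' : PreMatroid E} → ground M ≐ ground M' →
                       (∀ {B} → Base M B → Base M' B) → IndepTransfer (dual M) (dual M')
  dual-indepTransfer ground≐ base⇒ I≐I' (I⊆ground , B , B-base , I∩B=∅) =
    ⊆-resp-≐ I≐I' ground≐ I⊆ground , B , base⇒ B-base ,
    λ x x∈I' → I∩B=∅ x (trans (I≐I' x) x∈I')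

  dual-cong : {M M' : PreMatroid E} → M ≈ᴹ M' → dual M ≈ᴹ dual M'
  dual-cong M≈M'@(ground≐ , _ , _) =
    ground≐ ,
    dual-indepTransfer ground≐ (Base-resp M≈M' ≐-refl) ,
    dual-indepTransfer (≐-sym ground≐) (Base-resp (≈ᴹ-sym M≈M') ≐-refl)

  dual-≈ᴹ-refl : {M : PreMatroid E} → dual M ≈ᴹ dual M
  dual-≈ᴹ-refl = ≐-refl , dual-indepTransfer ≐-refl (λ B-base → B-base) ,
                         dual-indepTransfer ≐-refl (λ B-base → B-base)

  delete-cong : {M M' : PreMatroid E} → M ≈ᴹ M' → {X X' : Subset E} → X ≐ X' →
                delete M X ≈ᴹ delete M' X'
  delete-cong {M} {M'} (ground≐ , there , back) {X} {X'} X≐X' =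
    ground∖≐ ,
    (λ I≐I' (I-indep , I⊆) → there I≐I' I-indep , ⊆-resp-≐ I≐I' ground∖≐ I⊆) ,
    (λ I≐I' (I-indep , I⊆) → back I≐I' I-indep , ⊆-resp-≐ I≐I' (≐-sym ground∖≐) I⊆)
    where
    ground∖≐ : (ground M ∖ X) ≐ (ground M' ∖ X')
    ground∖≐ x = cong₂ (λ g y → g ∧ not y) (ground≐ x) (X≐X' x)

  -- indep M need not respect ≐, but a minor does: contraction only sees M through its bases.
  minor-cong : {M : PreMatroid E} {F F' G G' : Subset E} → F ≐ F' → G ≐ G' →
               minor M F G ≈ᴹ minor M F' G'
  minor-cong F≐F' G≐G' = delete-cong (dual-cong (delete-cong dual-≈ᴹ-refl F≐F')) G≐G'

  Circuit-resp : {M M' : PreMatroid E} → M ≈ᴹ M' → {C C' : Subset E} → C ≐ C' →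
                 Circuit M C → Circuit M' C'
  Circuit-resp (ground≐ , there , back) C≐C' (C⊆ground , C-dependent , C-minimal) =
    ⊆-resp-≐ C≐C' ground≐ C⊆ground ,
    (λ C'-indep → C-dependent (back (≐-sym C≐C') C'-indep)) ,
    λ D D⊆C' C'⊈D → there ≐-refl
      (C-minimal D (⊆-resp-≐ ≐-refl (≐-sym C≐C') D⊆C')
                   (λ C⊆D → C'⊈D (⊆-resp-≐ C≐C' ≐-refl C⊆D)))

  Cocircuit-resp : {M M' : PreMatroid E} → M ≈ᴹ M' → {C C' : Subset E} → C ≐ C' →
                   Cocircuit M C → Cocircuit M' C'
  Cocircuit-resp M≈M' = Circuit-resp (dual-cong M≈M')

flipS-involutive : ∀ s → flipS (flipS s) ≡ s
flipS-involutive ⊕ = refl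
flipS-involutive ⊖ = refl
flipS-involutive ○ = refl

isNonzero-flipS : ∀ s → isNonzero (flipS s) ≡ isNonzero s
isNonzero-flipS ⊕ = refl
isNonzero-flipS ⊖ = refl
isNonzero-flipS ○ = refl

isPlus⇒⊕ : ∀ {s} → isPlus s ≡ true → s ≡ ⊕
isPlus⇒⊕ {⊕} _ = refl

isNonzero≡isPlus : ∀ s → (isNonzero s ≡ true → s ≡ ⊕) → isNonzero s ≡ isPlus s
isNonzero≡isPlus ⊕ _ = refl
isNonzero≡isPlus ○ _ = refl
isNonzero≡isPlus ⊖ nonzero⇒⊕ = case nonzero⇒⊕ refl of λ ()

Exactly-cong : {P P' Q Q' : Set} → P ⇔ P' → Q ⇔ Q' → Exactly P Q → Exactly P' Q'
Exactly-cong P⇔P' Q⇔Q' (one , notBoth) =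
  Sum.map (to P⇔P') (to Q⇔Q') one ,
  λ (p , q) → notBoth (from P⇔P' p , from Q⇔Q' q)

module _ {E : Set} where

  restrict-∈ : ∀ (C : Signed E) S {x} → x ∈ S → restrict C S x ≡ C x
  restrict-∈ C S {x} x∈S with S x
  ... | true = refl

  restrict-∉ : ∀ (C : Signed E) S {x} → S x ≡ false → restrict C S x ≡ ○
  restrict-∉ C S {x} x∉S with S x
  ... | false = refl

  restrict-cong : ∀ (C : Signed E) {S S'} → S ≐ S' → restrict C S ≗ˢ restrict C S'
  restrict-cong C {S} {S'} S≐S' x with S x | S' x | S≐S' x
  ... | true  | .true  | refl = refl
  ... | false | .false | refl = refl

  support-restrict : ∀ (C : Signed E) S → support (restrict C S) ⊆ support C
  support-restrict C S x x∈ with S x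
  ... | true = x∈

  reorient-∈ : ∀ A (Z : Signed E) {x} → x ∈ A → reorient A Z x ≡ flipS (Z x)
  reorient-∈ A Z {x} x∈A with A x
  ... | true = refl

  reorient-∉ : ∀ A (Z : Signed E) {x} → A x ≡ false → reorient A Z x ≡ Z x
  reorient-∉ A Z {x} x∉A with A x
  ... | false = refl

  reorient-cong : ∀ A {Z Z' : Signed E} → Z ≗ˢ Z' → reorient A Z ≗ˢ reorient A Z'
  reorient-cong A Z≗Z' x with A x
  ... | true  = cong flipS (Z≗Z' x)
  ... | false = Z≗Z' x

  isNonzero-reorient : ∀ A (Z : Signed E) x → isNonzero (reorient A Z x) ≡ isNonzero (Z x)
  isNonzero-reorient A Z x with A x
  ... | true  = isNonzero-flipS (Z x)
  ... | false = refl

  support-resp : {X Y : Signed E} → X ≗ˢ Y → support X ≐ support Y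
  support-resp X≗Y x = cong isNonzero (X≗Y x)

  Positive-resp : {X Y : Signed E} → X ≗ˢ Y → Positive X → Positive Y
  Positive-resp {X} {Y} X≗Y (sign , x , x∈X) =
    (λ y → trans (sym (support-resp X≗Y y)) (trans (sign y) (cong isPlus (X≗Y y)))) ,
    x , trans (sym (support-resp X≗Y x)) x∈X

  positive⇒⊕ : {X : Signed E} → Positive X → ∀ {x} → x ∈ support X → X x ≡ ⊕
  positive⇒⊕ (sign , _) {x} x∈X = isPlus⇒⊕ (trans (sym (sign x)) x∈X)

module Painting {E : Set} (F G A N : Subset E) (F∩G=∅ : Disjoint F G)
                (N-def : ∀ x → N x ≡ not (F x) ∧ not (G x)) where

  paint : E → Colour
  paint x = if F x then cG else if G x then cR else if A x then cW else cB

  data Kind (x : E) : Colour → Set where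
    contracted : x ∈ F → G x ≡ false → N x ≡ false → Kind x cG
    deleted    : F x ≡ false → x ∈ G → N x ≡ false → Kind x cR
    reversed   : F x ≡ false → G x ≡ false → x ∈ N → x ∈ A → Kind x cW
    kept       : F x ≡ false → G x ≡ false → x ∈ N → A x ≡ false → Kind x cB

  kind : ∀ x → Kind x (paint x)
  kind x with F x in x∈F | G x in x∈G | N-def x
  ... | true  | true  | _  = ⊥-elim (F∩G=∅ x x∈F x∈G)
  ... | true  | false | N≡ = contracted x∈F x∈G N≡
  ... | false | true  | N≡ = deleted x∈F x∈G N≡
  ... | false | false | N≡ with A x in x∈A
  ...   | true  = reversed x∈F x∈G N≡ x∈A
  ...   | false = kept x∈F x∈G N≡ x∈A

  kindAt : ∀ {x c} → paint x ≡ c → Kind x c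
  kindAt {x} refl = kind x

  colSet-cG : colSet paint cG ≐ F
  colSet-cG x = byKind (paint x) (kind x)
    where
    byKind : ∀ c → Kind x c → (c ==ᶜ cG) ≡ F x
    byKind _ (contracted x∈F _ _)  = sym x∈F
    byKind _ (deleted x∉F _ _)     = sym x∉F
    byKind _ (reversed x∉F _ _ _)  = sym x∉F
    byKind _ (kept x∉F _ _ _)      = sym x∉F

  colSet-cR : colSet paint cR ≐ G
  colSet-cR x = byKind (paint x) (kind x)
    where
    byKind : ∀ c → Kind x c → (c ==ᶜ cR) ≡ G x
    byKind _ (contracted _ x∉G _)  = sym x∉G
    byKind _ (deleted _ x∈G _)     = sym x∈G
    byKind _ (reversed _ x∉G _ _)  = sym x∉G
    byKind _ (kept _ x∉G _ _)      = sym x∉G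

  colSet-cB∪cW : (colSet paint cB ∪ colSet paint cW) ≐ N
  colSet-cB∪cW x = byKind (paint x) (kind x)
    where
    byKind : ∀ c → Kind x c → ((c ==ᶜ cB) ∨ (c ==ᶜ cW)) ≡ N x
    byKind _ (contracted _ _ x∉N)  = sym x∉N
    byKind _ (deleted _ _ x∉N)     = sym x∉N
    byKind _ (reversed _ _ x∈N _)  = sym x∈N
    byKind _ (kept _ _ x∈N _)      = sym x∈N

  BlackOrWhite : E → Set
  BlackOrWhite x = paint x ≡ cB ⊎ paint x ≡ cW

  BlackWhiteOr : Colour → E → Set
  BlackWhiteOr K x = paint x ≡ cB ⊎ paint x ≡ cW ⊎ paint x ≡ K

  N⇒BlackOrWhite : ∀ {x} → x ∈ N → BlackOrWhite x
  N⇒BlackOrWhite {x} x∈N with paint x | kind x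
  ... | cB | _ = inj₁ refl
  ... | cW | _ = inj₂ refl
  ... | cG | contracted _ _ x∉N = case trans (sym x∉N) x∈N of λ ()
  ... | cR | deleted _ _ x∉N    = case trans (sym x∉N) x∈N of λ ()

  N∪F⇔BlackWhiteOrGreen : ∀ {x} → x ∈ (N ∪ F) ⇔ BlackWhiteOr cG x
  N∪F⇔BlackWhiteOrGreen {x} = mk⇔ (⇒ (paint x) (kind x)) ⇐
    where
    ⇒ : ∀ c → Kind x c → x ∈ (N ∪ F) → c ≡ cB ⊎ c ≡ cW ⊎ c ≡ cG
    ⇒ _ (kept _ _ _ _)              _ = inj₁ refl
    ⇒ _ (reversed _ _ _ _)          _ = inj₂ (inj₁ refl)
    ⇒ _ (contracted _ _ _)          _ = inj₂ (inj₂ refl)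
    ⇒ _ (deleted x∉F _ x∉N) x∈N∪F = ⊥-elim (∉-∪ {S = N} {T = F} x∉N x∉F x∈N∪F)
    ⇐ : BlackWhiteOr cG x → x ∈ (N ∪ F)
    ⇐ (inj₁ black) with kindAt black
    ... | kept _ _ x∈N _ = ∈-∪ˡ {S = N} {T = F} x∈N
    ⇐ (inj₂ (inj₁ white)) with kindAt white
    ... | reversed _ _ x∈N _ = ∈-∪ˡ {S = N} {T = F} x∈N
    ⇐ (inj₂ (inj₂ green)) with kindAt green
    ... | contracted x∈F _ _ = ∈-∪ʳ {S = N} {T = F} x∈F

  N∪G⇔BlackWhiteOrRed : ∀ {x} → x ∈ (N ∪ G) ⇔ BlackWhiteOr cR x
  N∪G⇔BlackWhiteOrRed {x} = mk⇔ (⇒ (paint x) (kind x)) ⇐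
    where
    ⇒ : ∀ c → Kind x c → x ∈ (N ∪ G) → c ≡ cB ⊎ c ≡ cW ⊎ c ≡ cR
    ⇒ _ (kept _ _ _ _)              _ = inj₁ refl
    ⇒ _ (reversed _ _ _ _)          _ = inj₂ (inj₁ refl)
    ⇒ _ (deleted _ _ _)             _ = inj₂ (inj₂ refl)
    ⇒ _ (contracted _ x∉G x∉N) x∈N∪G = ⊥-elim (∉-∪ {S = N} {T = G} x∉N x∉G x∈N∪G)
    ⇐ : BlackWhiteOr cR x → x ∈ (N ∪ G)
    ⇐ (inj₁ black) with kindAt black
    ... | kept _ _ x∈N _ = ∈-∪ˡ {S = N} {T = G} x∈N
    ⇐ (inj₂ (inj₁ white)) with kindAt white
    ... | reversed _ _ x∈N _ = ∈-∪ˡ {S = N} {T = G} x∈N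
    ⇐ (inj₂ (inj₂ red)) with kindAt red
    ... | deleted _ x∈G _ = ∈-∪ʳ {S = N} {T = G} x∈G

  orient : Signed E → Signed E
  orient C = reorient A (restrict C N)

  orient-kept : ∀ C {x} → x ∈ N → A x ≡ false → orient C x ≡ C x
  orient-kept C x∈N x∉A = trans (reorient-∉ A (restrict C N) x∉A) (restrict-∈ C N x∈N)

  orient-reversed : ∀ C {x} → x ∈ N → x ∈ A → orient C x ≡ flipS (C x)
  orient-reversed C x∈N x∈A = trans (reorient-∈ A (restrict C N) x∈A) (cong flipS (restrict-∈ C N x∈N))

  orient-outside : ∀ C {x} → N x ≡ false → orient C x ≡ ○
  orient-outside C {x} x∉N with A x
  ... | true  = cong flipS (restrict-∉ C N x∉N)
  ... | false = restrict-∉ C N x∉N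

  support-orient⊆ : ∀ C → support (orient C) ⊆ support C
  support-orient⊆ C x x∈ =
    support-restrict C N x (trans (sym (isNonzero-reorient A (restrict C N) x)) x∈)

  support-orient-∈ : ∀ C {x} → x ∈ N → x ∈ support C → x ∈ support (orient C)
  support-orient-∈ C {x} x∈N x∈C =
    trans (isNonzero-reorient A (restrict C N) x) (trans (cong isNonzero (restrict-∈ C N x∈N)) x∈C)

  painted⇒positive : ∀ {K C e} → e ∈ N → Painted paint K C e →
                     Positive (orient C) × e ∈ support (orient C)
  painted⇒positive {C = C} {e} e∈N (e∈C , _ , black⇒⊕ , white⇒⊖) = (sign , e , e∈X) , e∈X
    where
    e∈X : e ∈ support (orient C)
    e∈X = support-orient-∈ C e∈N e∈C
    sign : support (orient C) ≐ plusPart (orient C)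
    sign x with paint x in colour | kind x
    ... | cG | contracted _ _ x∉N rewrite orient-outside C x∉N = refl
    ... | cR | deleted _ _ x∉N    rewrite orient-outside C x∉N = refl
    ... | cB | kept _ _ x∈N x∉A   rewrite orient-kept C x∈N x∉A =
      isNonzero≡isPlus (C x) (λ x∈C → black⇒⊕ x x∈C colour)
    ... | cW | reversed _ _ x∈N x∈A rewrite orient-reversed C x∈N x∈A =
      isNonzero≡isPlus (flipS (C x)) λ x∈-C →
        cong flipS (white⇒⊖ x (trans (sym (isNonzero-flipS (C x))) x∈-C) colour)

  positive⇒painted : ∀ {H K C e} → (∀ {x} → x ∈ (N ∪ H) → BlackWhiteOr K x) →
                     support C ⊆ (N ∪ H) → Positive (orient C) → e ∈ support (orient C) →
                     Painted paint K C e
  positive⇒painted {C = C} {e} colours C⊆N∪H positive e∈X =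
    support-orient⊆ C e e∈X , (λ x x∈C → colours (C⊆N∪H x x∈C)) , black⇒⊕ , white⇒⊖
    where
    black⇒⊕ : ∀ x → x ∈ support C → paint x ≡ cB → C x ≡ ⊕
    black⇒⊕ x x∈C black with kindAt black
    ... | kept _ _ x∈N x∉A =
      trans (sym (orient-kept C x∈N x∉A)) (positive⇒⊕ positive (support-orient-∈ C x∈N x∈C))
    white⇒⊖ : ∀ x → x ∈ support C → paint x ≡ cW → C x ≡ ⊖
    white⇒⊖ x x∈C white with kindAt white
    ... | reversed _ _ x∈N x∈A =
      trans (sym (flipS-involutive (C x)))
        (cong flipS (trans (sym (orient-reversed C x∈N x∈A))
          (positive⇒⊕ positive (support-orient-∈ C x∈N x∈C))))

  Induced : (Subset E → Set) → Subset E → SignedSet E → SignedSet E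
  Induced IsCircuit H 𝒞 Z = Σ (Signed E) λ C → 𝒞 C × Z ≗ˢ restrict C N ×
    IsCircuit (support Z) × support C ⊆ (N ∪ H)

  PositiveThrough : SignedSet E → E → Set
  PositiveThrough 𝒮 e = Σ (Signed E) λ X → 𝒮 X × Positive X × e ∈ support X

  PaintedBy : Colour → SignedSet E → E → Set
  PaintedBy K 𝒞 e = Σ (Signed E) λ C → 𝒞 C × Painted paint K C e

  induced⇒painted : ∀ IsCircuit H {K 𝒞 e} → (∀ {x} → x ∈ (N ∪ H) → BlackWhiteOr K x) →
                    PositiveThrough (reorientSet A (Induced IsCircuit H 𝒞)) e → PaintedBy K 𝒞 e
  induced⇒painted _ _ {e = e} colours
    (X , (Z , (C , C∈𝒞 , Z≗C|N , _ , C⊆N∪H) , X≗Z) , positive , e∈X) =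
    C , C∈𝒞 , positive⇒painted colours C⊆N∪H (Positive-resp X≗orient positive)
                (trans (sym (support-resp X≗orient e)) e∈X)
    where
    X≗orient : X ≗ˢ orient C
    X≗orient x = trans (X≗Z x) (reorient-cong A Z≗C|N x)

  painted⇒induced : ∀ IsCircuit H {K 𝒞 e} → (∀ {x} → BlackWhiteOr K x → x ∈ (N ∪ H)) → e ∈ N →
                    (Σ (Signed E) λ C → 𝒞 C × Painted paint K C e × IsCircuit (support (restrict C N))) →
                    PositiveThrough (reorientSet A (Induced IsCircuit H 𝒞)) e
  painted⇒induced _ _ colours e∈N (C , C∈𝒞 , painted@(_ , coloured , _) , circuit) =
    orient C ,
    (restrict C N , (C , C∈𝒞 , (λ _ → refl) , circuit , λ x x∈C → colours (coloured x x∈C)) ,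
     λ _ → refl) ,
    painted⇒positive e∈N painted

ground-minor : ∀ {E} (M : PreMatroid E) → ground M ≐ full → ∀ F G x →
               ground (minor M F G) x ≡ not (F x) ∧ not (G x)
ground-minor M ground≐full F G x rewrite ground≐full x = refl

minor-farkas : ∀ {E} (M : PreMatroid E) → ground M ≐ full → (𝒞 𝒞* : SignedSet E) →
               FourPainting 𝒞 𝒞* → MinimalChoice M 𝒞 𝒞* →
               ∀ F G → Disjoint F G → ∀ A →
               FarkasProperty (ground (minor M F G))
                 (reorientSet A (SC M 𝒞 F G)) (reorientSet A (SC* M 𝒞* F G))
minor-farkas M ground≐full 𝒞 𝒞* fourPainting minimalChoice F G F∩G=∅ A e e∈N =
  Exactly-cong circuits cocircuits (fourPainting paint e e-colour)
  where
  open Painting F G A (ground (minor M F G)) F∩G=∅ (ground-minor M ground≐full F G)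
  e-colour : BlackOrWhite e
  e-colour = N⇒BlackOrWhite e∈N
  painted≈minor : minor M (colSet paint cG) (colSet paint cR) ≈ᴹ minor M F G
  painted≈minor = minor-cong colSet-cG colSet-cR
  support-restrict≐ : ∀ C → support (restrict C (colSet paint cB ∪ colSet paint cW))
                          ≐ support (restrict C (ground (minor M F G)))
  support-restrict≐ C = support-resp (restrict-cong C colSet-cB∪cW)
  circuits : PaintedBy cG 𝒞 e ⇔ PositiveThrough (reorientSet A (SC M 𝒞 F G)) e
  circuits = mk⇔
    (λ painted → case proj₁ (minimalChoice paint e e-colour) painted of λ where
      (C , C∈𝒞 , C-painted , circuit) →
        painted⇒induced (Circuit (minor M F G)) F (from N∪F⇔BlackWhiteOrGreen) e∈N
          (C , C∈𝒞 , C-painted , Circuit-resp painted≈minor (support-restrict≐ C) circuit))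
    (induced⇒painted (Circuit (minor M F G)) F (to N∪F⇔BlackWhiteOrGreen))
  cocircuits : PaintedBy cR 𝒞* e ⇔ PositiveThrough (reorientSet A (SC* M 𝒞* F G)) e
  cocircuits = mk⇔
    (λ painted → case proj₂ (minimalChoice paint e e-colour) painted of λ where
      (U , U∈𝒞* , U-painted , cocircuit) →
        painted⇒induced (Cocircuit (minor M F G)) G (from N∪G⇔BlackWhiteOrRed) e∈N
          (U , U∈𝒞* , U-painted , Cocircuit-resp painted≈minor (support-restrict≐ U) cocircuit))
    (induced⇒painted (Cocircuit (minor M F G)) G (to N∪G⇔BlackWhiteOrRed))

lemma5p10 : {E : Set} (M : PreMatroid E) → IsMatroid M → ground M ≐ full →
    (𝒞 𝒞* : SignedSet E) → IsCircuitSignature M 𝒞 → IsCocircuitSignature M 𝒞* →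
    FourPainting 𝒞 𝒞* → MinimalChoice M 𝒞 𝒞* →
    FarkasPropertyOriented M 𝒞 𝒞*
lemma5p10 M _ ground≐full 𝒞 𝒞* _ _ fourPainting minimalChoice F G F∩G=∅ A _ =
  minor-farkas M ground≐full 𝒞 𝒞* fourPainting minimalChoice F G F∩G=∅ A
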